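{- Let $G$ be a graph of order $n$ with maximum degree $\Delta=\Delta(G)$ and minimum degree $\delta=\delta(G)$. Then $$\rho(G)=L_1(G)\ \ge\ \frac{n+\Delta(\Delta-\delta)}{\Delta^2+1}\ \ge\ \frac{n}{\Delta^2+1}.$$
   Context: All graphs are finite, simple and undirected. For a vertex $v$, $N[v]$ denotes the closed neighbourhood of $v$. A vertex set $X\subseteq V(G)$ is a $1$-limited packing if $|N[v]\cap X|\le 1$ for every $v\in V(G)$ (equivalently, any two vertices of $X$ are at distance at least $3$); $L_1(G)$ is the maximum size of such a set, and the $2$-packing number is $\rho(G)=L_1(G)$. $\Delta(G)$ and $\delta(G)$ are the maximum and minimum vertex degrees. -}

module Defs where

open import Data.Bool using (Bool; true; false; _∨_)
open import Data.Nat using (ℕ; zero; suc; _≤_; _⊔_; _⊓_; _≤?_)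
open import Data.Fin using (Fin)
open import Data.Fin.Properties using (all?) renaming (_≟_ to _≟ᶠ_)
open import Data.Fin.Subset using (Subset; _∩_; ∣_∣)
open import Data.Vec using (Vec; []; _∷_; tabulate)
open import Data.List using (List; []; _∷_; map; _++_; foldr; filter; allFin)
open import Relation.Nullary using (Dec; does)
open import Relation.Binary.PropositionalEquality using (_≡_)

record Graph (n : ℕ) : Set where
  field
    adj    : Fin n → Fin n → Bool
    sym    : ∀ u v → adj u v ≡ adj v u
    irrefl : ∀ v → adj v v ≡ false
open Graph public

module _ {n : ℕ} (G : Graph n) where

  N⟨_⟩ : Fin n → Subset n
  N⟨ v ⟩ = tabulate (λ u → adj G v u)

  N[_] : Fin n → Subset n
  N[ v ] = tabulate (λ u → does (v ≟ᶠ u) ∨ adj G v u)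

  deg : Fin n → ℕ
  deg v = ∣ N⟨ v ⟩ ∣

  -- maximum degree Δ(G) (0 for the empty graph)
  maxDeg : ℕ
  maxDeg = foldr (λ v m → deg v ⊔ m) 0 (allFin n)

  -- minimum degree δ(G) (the fold starts from Δ(G), so for n ≥ 1 this
  -- is exactly the minimum of the degrees; for n = 0 it is 0)
  minDeg : ℕ
  minDeg = foldr (λ v m → deg v ⊓ m) maxDeg (allFin n)

  IsLimitedPacking : Subset n → Set
  IsLimitedPacking X = ∀ v → ∣ N[ v ] ∩ X ∣ ≤ 1

  isLimitedPacking? : (X : Subset n) → Dec (IsLimitedPacking X)
  isLimitedPacking? X = all? (λ v → ∣ N[ v ] ∩ X ∣ ≤? 1)

allSubsets : (n : ℕ) → List (Subset n)
allSubsets zero = [] ∷ []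
allSubsets (suc n) = map (true ∷_) (allSubsets n) ++ map (false ∷_) (allSubsets n)

L₁ : {n : ℕ} → Graph n → ℕ
L₁ {n} G = foldr _⊔_ 0 (map ∣_∣ (filter (isLimitedPacking? G) (allSubsets n)))

ρ : {n : ℕ} → Graph n → ℕ
ρ = L₁

-- Greedily extend {v₀}, with v₀ of minimum degree, to a maximal 2-packing X: every
-- vertex then lies within distance 2 of X. The ball of radius 2 around x has at most
-- 1 + deg(x) Δ vertices, so n ≤ (1 + δΔ) + (|X| - 1)(1 + Δ²), which rearranges to
-- n + Δ(Δ - δ) ≤ |X| (Δ² + 1); and X, being a 2-packing, is a 1-limited packing.
module Submission where

open import Data.Bool using (Bool; true; false; _∨_)
open import Data.Bool.Properties using (∨-zeroʳ)
open import Data.Fin using (Fin; zero; suc)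
open import Data.Fin.Properties using () renaming (_≟_ to _≟ᶠ_)
open import Data.Fin.Subset
  using (Subset; inside; outside; ⊥; ⊤; ⁅_⁆; _∈_; _∉_; _⊆_; _∩_; _∪_; _-_; ∣_∣)
open import Data.Fin.Subset.Properties
  using ( x∈p∪q⁺; x∈p∪q⁻; x∈p∩q⁻; p⊆q⇒∣p∣≤∣q∣; ∣⊥∣≡0; ∉⊥; ∣⊤∣≡n; x∈⁅x⁆; x∈⁅y⁆⇒x≡y
        ; ∣⁅x⁆∣≡1; x∈p⇒∣p-x∣<∣p∣; x∈p∧x≢y⇒x∈p-y; q⊆p∪q; nonempty?; Empty-unique; _∈?_ )
open import Data.Integer as ℤ using (+_; +≤+)
import Data.Integer.Properties as ℤ
open import Data.List using (List; []; _∷_; foldr; map; allFin)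
open import Data.List.Membership.Propositional.Properties
  using (∈-map⁺; ∈-map⁻; ∈-filter⁺; ∈-allFin; ∈-++⁺ˡ; ∈-++⁺ʳ; foldr-selective)
open import Data.List.Properties using (foldr-map)
open import Data.List.Relation.Unary.All as All using (All; []; _∷_)
import Data.List.Relation.Unary.Any as Any
import Data.List.Membership.Propositional as List
open import Data.Nat as ℕ using (ℕ; zero; suc; _+_; _*_; _∸_; _⊔_; _⊓_; z≤n; s≤s)
open import Data.Nat.Properties
open import Algebra.Properties.CommutativeSemigroup +-commutativeSemigroup using (xy∙z≈xz∙y)
open import Data.Product using (∃; _×_; _,_)
open import Data.Rational using (_/_; _≤_)
open import Data.Rational.Properties using (toℚᵘ-fromℚᵘ; toℚᵘ-cancel-≤)
import Data.Rational.Unnormalised as ℚᵘ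
import Data.Rational.Unnormalised.Properties as ℚᵘ
open import Data.Sum using (_⊎_; inj₁; inj₂)
open import Data.Vec using ([]; _∷_; tabulate; here; there)
open import Data.Vec.Properties using (lookup∘tabulate; []=⇒lookup; lookup⇒[]=)
open import Function using (_∘_)
open import Relation.Binary.PropositionalEquality
open import Relation.Nullary using (yes; no; does; contradiction)
open import Relation.Nullary.Decidable using (dec-true)

open import Defs hiding (sym; N⟨_⟩; N[_]; deg)

private
  variable
    m n : ℕ

≤-foldr-⊔ : ∀ {A : Set} (f : A → ℕ) b {x} xs → x List.∈ xs → f x ℕ.≤ foldr (λ v k → f v ⊔ k) b xs
≤-foldr-⊔ f b (y ∷ xs) (Any.here refl) = m≤m⊔n (f y) _
≤-foldr-⊔ f b (y ∷ xs) (Any.there x∈xs) = ≤-trans (≤-foldr-⊔ f b xs x∈xs) (m≤n⊔m (f y) _)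

∣p∪q∣≤∣p∣+∣q∣ : ∀ (p q : Subset n) → ∣ p ∪ q ∣ ℕ.≤ ∣ p ∣ + ∣ q ∣
∣p∪q∣≤∣p∣+∣q∣ [] [] = z≤n
∣p∪q∣≤∣p∣+∣q∣ (inside ∷ p) (outside ∷ q) = s≤s (∣p∪q∣≤∣p∣+∣q∣ p q)
∣p∪q∣≤∣p∣+∣q∣ (inside ∷ p) (inside ∷ q) = s≤s (≤-trans (∣p∪q∣≤∣p∣+∣q∣ p q) (+-monoʳ-≤ ∣ p ∣ (n≤1+n ∣ q ∣)))
∣p∪q∣≤∣p∣+∣q∣ (outside ∷ p) (outside ∷ q) = ∣p∪q∣≤∣p∣+∣q∣ p q
∣p∪q∣≤∣p∣+∣q∣ (outside ∷ p) (inside ∷ q) =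
  ≤-trans (s≤s (∣p∪q∣≤∣p∣+∣q∣ p q)) (≤-reflexive (sym (+-suc ∣ p ∣ ∣ q ∣)))

subsingleton⇒∣p∣≤1 : ∀ (p : Subset n) → (∀ {x y} → x ∈ p → y ∈ p → x ≡ y) → ∣ p ∣ ℕ.≤ 1
subsingleton⇒∣p∣≤1 {n = n} p unique with nonempty? p
... | yes (x , x∈p) = begin
  ∣ p ∣     ≤⟨ p⊆q⇒∣p∣≤∣q∣ (λ y∈p → subst (_∈ ⁅ x ⁆) (unique x∈p y∈p) (x∈⁅x⁆ x)) ⟩
  ∣ ⁅ x ⁆ ∣ ≡⟨ ∣⁅x⁆∣≡1 x ⟩
  1         ∎
  where open ≤-Reasoning
... | no p-empty = ≤-trans (≤-reflexive (trans (cong ∣_∣ (Empty-unique p-empty)) (∣⊥∣≡0 n))) z≤n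

⋃ᵢ : Subset m → (Fin m → Subset n) → Subset n
⋃ᵢ [] A = ⊥
⋃ᵢ (outside ∷ S) A = ⋃ᵢ S (A ∘ suc)
⋃ᵢ (inside ∷ S) A = A zero ∪ ⋃ᵢ S (A ∘ suc)

syntax ⋃ᵢ S (λ x → A) = ⋃[ x ∈ S ] A

∈⋃ᵢ⁺ : ∀ {S : Subset m} {A : Fin m → Subset n} {x y} → x ∈ S → y ∈ A x → y ∈ ⋃ᵢ S A
∈⋃ᵢ⁺ {S = inside ∷ S} here y∈A = x∈p∪q⁺ (inj₁ y∈A)
∈⋃ᵢ⁺ {S = inside ∷ S} (there x∈S) y∈A = x∈p∪q⁺ (inj₂ (∈⋃ᵢ⁺ x∈S y∈A))
∈⋃ᵢ⁺ {S = outside ∷ S} (there x∈S) y∈A = ∈⋃ᵢ⁺ x∈S y∈A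

∈⋃ᵢ⁻ : ∀ (S : Subset m) (A : Fin m → Subset n) {y} → y ∈ ⋃ᵢ S A → ∃ λ x → x ∈ S × y ∈ A x
∈⋃ᵢ⁻ [] A y∈⊥ = contradiction y∈⊥ ∉⊥
∈⋃ᵢ⁻ (outside ∷ S) A y∈⋃ with ∈⋃ᵢ⁻ S (A ∘ suc) y∈⋃
... | x , x∈S , y∈A = suc x , there x∈S , y∈A
∈⋃ᵢ⁻ (inside ∷ S) A y∈⋃ with x∈p∪q⁻ (A zero) _ y∈⋃
... | inj₁ y∈A = zero , here , y∈A
... | inj₂ y∈⋃′ with ∈⋃ᵢ⁻ S (A ∘ suc) y∈⋃′
...   | x , x∈S , y∈A = suc x , there x∈S , y∈A

∣⋃ᵢ∣≤ : ∀ (S : Subset m) (A : Fin m → Subset n) {k} →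
        (∀ {x} → x ∈ S → ∣ A x ∣ ℕ.≤ k) → ∣ ⋃ᵢ S A ∣ ℕ.≤ ∣ S ∣ * k
∣⋃ᵢ∣≤ {n = n} [] A bound = ≤-reflexive (∣⊥∣≡0 n)
∣⋃ᵢ∣≤ (outside ∷ S) A bound = ∣⋃ᵢ∣≤ S (A ∘ suc) (bound ∘ there)
∣⋃ᵢ∣≤ (inside ∷ S) A bound = ≤-trans (∣p∪q∣≤∣p∣+∣q∣ (A zero) _)
  (+-mono-≤ (bound here) (∣⋃ᵢ∣≤ S (A ∘ suc) (bound ∘ there)))

⋃ᵢ-mono : ∀ {S T : Subset m} (A : Fin m → Subset n) → S ⊆ T → ⋃ᵢ S A ⊆ ⋃ᵢ T A
⋃ᵢ-mono {S = S} A S⊆T y∈⋃ with ∈⋃ᵢ⁻ S A y∈⋃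
... | x , x∈S , y∈A = ∈⋃ᵢ⁺ (S⊆T x∈S) y∈A

⋃ᵢ⊆∪⋃ᵢ- : ∀ (S : Subset m) (A : Fin m → Subset n) x → ⋃ᵢ S A ⊆ A x ∪ ⋃ᵢ (S - x) A
⋃ᵢ⊆∪⋃ᵢ- S A x y∈⋃ with ∈⋃ᵢ⁻ S A y∈⋃
... | z , z∈S , y∈A with z ≟ᶠ x
...   | yes refl = x∈p∪q⁺ (inj₁ y∈A)
...   | no z≢x = x∈p∪q⁺ (inj₂ (∈⋃ᵢ⁺ (x∈p∧x≢y⇒x∈p-y z∈S z≢x) y∈A))

∈-tabulate⁺ : ∀ {f : Fin n → Bool} {x} → f x ≡ true → x ∈ tabulate f
∈-tabulate⁺ {f = f} {x} fx≡true = lookup⇒[]= x (tabulate f) (trans (lookup∘tabulate f x) fx≡true)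

∈-tabulate⁻ : ∀ {f : Fin n → Bool} {x} → x ∈ tabulate f → f x ≡ true
∈-tabulate⁻ {f = f} {x} x∈f = trans (sym (lookup∘tabulate f x)) ([]=⇒lookup x∈f)

∈-allSubsets : ∀ (X : Subset n) → X List.∈ allSubsets n
∈-allSubsets [] = Any.here refl
∈-allSubsets (true ∷ X) = ∈-++⁺ˡ (∈-map⁺ (true ∷_) (∈-allSubsets X))
∈-allSubsets (false ∷ X) = ∈-++⁺ʳ _ (∈-map⁺ (false ∷_) (∈-allSubsets X))

excess-bound : ∀ {d δ} Δ → d ℕ.≤ δ → d ℕ.≤ Δ → d * Δ + Δ * (Δ ∸ δ) ℕ.≤ Δ * Δ
excess-bound {d} {δ} Δ d≤δ d≤Δ = begin
  d * Δ + Δ * (Δ ∸ δ) ≤⟨ +-monoʳ-≤ (d * Δ) (*-monoʳ-≤ Δ (∸-monoʳ-≤ Δ d≤δ)) ⟩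
  d * Δ + Δ * (Δ ∸ d) ≡⟨ cong (_+ Δ * (Δ ∸ d)) (*-comm d Δ) ⟩
  Δ * d + Δ * (Δ ∸ d) ≡⟨ sym (*-distribˡ-+ Δ d (Δ ∸ d)) ⟩
  Δ * (d + (Δ ∸ d))   ≡⟨ cong (Δ *_) (m+[n∸m]≡n d≤Δ) ⟩
  Δ * Δ               ∎
  where open ≤-Reasoning

module _ (G : Graph n) where

  N⟨_⟩ N[_] : Fin n → Subset n
  N⟨_⟩ = Defs.N⟨_⟩ G
  N[_] = Defs.N[_] G

  deg : Fin n → ℕ
  deg = Defs.deg G

  Δ δ : ℕ
  Δ = maxDeg G
  δ = minDeg G

  deg≤Δ : ∀ v → deg v ℕ.≤ Δ
  deg≤Δ v = ≤-foldr-⊔ deg 0 (allFin n) (∈-allFin v)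

  δ≡foldr-⊓ : δ ≡ foldr _⊓_ Δ (map deg (allFin n))
  δ≡foldr-⊓ = sym (foldr-map _⊓_ deg Δ (allFin n))

  minDeg-attained : Fin n → ∃ λ v → deg v ℕ.≤ δ
  minDeg-attained w with foldr-selective ⊓-sel Δ (map deg (allFin n))
  ... | inj₁ δ≡Δ = w , ≤-trans (deg≤Δ w) (≤-reflexive (sym (trans δ≡foldr-⊓ δ≡Δ)))
  ... | inj₂ δ∈degs with ∈-map⁻ deg δ∈degs
  ...   | v , _ , δ≡deg = v , ≤-reflexive (sym (trans δ≡foldr-⊓ δ≡deg))

  ∈N⟨⟩-sym : ∀ {u v} → u ∈ N⟨ v ⟩ → v ∈ N⟨ u ⟩
  ∈N⟨⟩-sym {u} {v} u∈N⟨v⟩ = ∈-tabulate⁺ (trans (Graph.sym G u v) (∈-tabulate⁻ u∈N⟨v⟩))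

  N⟨⟩⊆N[] : ∀ {v} → N⟨ v ⟩ ⊆ N[ v ]
  N⟨⟩⊆N[] {v} {u} u∈N⟨v⟩ =
    ∈-tabulate⁺ (trans (cong (does (v ≟ᶠ u) ∨_) (∈-tabulate⁻ u∈N⟨v⟩)) (∨-zeroʳ _))

  v∈N[v] : ∀ v → v ∈ N[ v ]
  v∈N[v] v = ∈-tabulate⁺ (cong (_∨ adj G v v) (dec-true (v ≟ᶠ v) refl))

  ∈N[]⁻ : ∀ {u v} → u ∈ N[ v ] → v ≡ u ⊎ u ∈ N⟨ v ⟩
  ∈N[]⁻ {u} {v} u∈N[v] with v ≟ᶠ u | ∈-tabulate⁻ {f = λ w → does (v ≟ᶠ w) ∨ adj G v w} u∈N[v]
  ... | yes v≡u | _ = inj₁ v≡u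
  ... | no _ | vu-adjacent = inj₂ (∈-tabulate⁺ vu-adjacent)

  ∈N[]-sym : ∀ {u v} → u ∈ N[ v ] → v ∈ N[ u ]
  ∈N[]-sym {u} u∈N[v] with ∈N[]⁻ u∈N[v]
  ... | inj₁ refl = v∈N[v] u
  ... | inj₂ u∈N⟨v⟩ = N⟨⟩⊆N[] (∈N⟨⟩-sym u∈N⟨v⟩)

  ∣N[v]∣≤1+deg : ∀ v → ∣ N[ v ] ∣ ℕ.≤ suc (deg v)
  ∣N[v]∣≤1+deg v = begin
    ∣ N[ v ] ∣               ≤⟨ p⊆q⇒∣p∣≤∣q∣ N[v]⊆⁅v⁆∪N⟨v⟩ ⟩
    ∣ ⁅ v ⁆ ∪ N⟨ v ⟩ ∣       ≤⟨ ∣p∪q∣≤∣p∣+∣q∣ ⁅ v ⁆ N⟨ v ⟩ ⟩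
    ∣ ⁅ v ⁆ ∣ + ∣ N⟨ v ⟩ ∣   ≡⟨ cong (_+ deg v) (∣⁅x⁆∣≡1 v) ⟩
    suc (deg v)              ∎
    where
    open ≤-Reasoning
    N[v]⊆⁅v⁆∪N⟨v⟩ : N[ v ] ⊆ ⁅ v ⁆ ∪ N⟨ v ⟩
    N[v]⊆⁅v⁆∪N⟨v⟩ u∈N[v] with ∈N[]⁻ u∈N[v]
    ... | inj₁ refl = x∈p∪q⁺ (inj₁ (x∈⁅x⁆ v))
    ... | inj₂ u∈N⟨v⟩ = x∈p∪q⁺ (inj₂ u∈N⟨v⟩)

  ∣N[v]-x∣≤Δ : ∀ {x v} → x ∈ N[ v ] → ∣ N[ v ] - x ∣ ℕ.≤ Δ
  ∣N[v]-x∣≤Δ {x} {v} x∈N[v] =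
    ≤-pred (≤-trans (x∈p⇒∣p-x∣<∣p∣ x∈N[v]) (≤-trans (∣N[v]∣≤1+deg v) (s≤s (deg≤Δ v))))

  N₂[_] : Fin n → Subset n
  N₂[ x ] = ⋃[ v ∈ N[ x ] ] N[ v ]

  x∈N₂[x] : ∀ x → x ∈ N₂[ x ]
  x∈N₂[x] x = ∈⋃ᵢ⁺ (v∈N[v] x) (v∈N[v] x)

  ∈N₂-sym : ∀ {x y} → y ∈ N₂[ x ] → x ∈ N₂[ y ]
  ∈N₂-sym {x} y∈N₂[x] with ∈⋃ᵢ⁻ N[ x ] N[_] y∈N₂[x]
  ... | v , v∈N[x] , y∈N[v] = ∈⋃ᵢ⁺ (∈N[]-sym y∈N[v]) (∈N[]-sym v∈N[x])

  ∣N₂[x]∣≤1+deg*Δ : ∀ x → ∣ N₂[ x ] ∣ ℕ.≤ suc (deg x * Δ)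
  ∣N₂[x]∣≤1+deg*Δ x = begin
    ∣ N₂[ x ] ∣                                 ≤⟨ p⊆q⇒∣p∣≤∣q∣ N₂[x]⊆ ⟩
    ∣ ⁅ x ⁆ ∪ ⋃[ v ∈ N⟨ x ⟩ ] (N[ v ] - x) ∣     ≤⟨ ∣p∪q∣≤∣p∣+∣q∣ ⁅ x ⁆ _ ⟩
    ∣ ⁅ x ⁆ ∣ + ∣ ⋃[ v ∈ N⟨ x ⟩ ] (N[ v ] - x) ∣
      ≤⟨ +-mono-≤ (≤-reflexive (∣⁅x⁆∣≡1 x)) (∣⋃ᵢ∣≤ N⟨ x ⟩ _ (∣N[v]-x∣≤Δ ∘ N⟨⟩⊆N[] ∘ ∈N⟨⟩-sym)) ⟩
    suc (deg x * Δ)                             ∎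
    where
    open ≤-Reasoning
    N₂[x]⊆ : N₂[ x ] ⊆ ⁅ x ⁆ ∪ ⋃[ v ∈ N⟨ x ⟩ ] (N[ v ] - x)
    N₂[x]⊆ {u} u∈N₂[x] with u ≟ᶠ x | ∈⋃ᵢ⁻ N[ x ] N[_] u∈N₂[x]
    ... | yes refl | _ = x∈p∪q⁺ (inj₁ (x∈⁅x⁆ x))
    ... | no u≢x | v , v∈N[x] , u∈N[v] with ∈N[]⁻ v∈N[x] | ∈N[]⁻ u∈N[v]
    ...   | inj₂ v∈N⟨x⟩ | _ = x∈p∪q⁺ (inj₂ (∈⋃ᵢ⁺ v∈N⟨x⟩ (x∈p∧x≢y⇒x∈p-y u∈N[v] u≢x)))
    ...   | inj₁ refl | inj₁ refl = contradiction refl u≢x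
    ...   | inj₁ refl | inj₂ u∈N⟨x⟩ = x∈p∪q⁺ (inj₂ (∈⋃ᵢ⁺ u∈N⟨x⟩ (x∈p∧x≢y⇒x∈p-y (v∈N[v] u) u≢x)))

  Is2Packing : Subset n → Set
  Is2Packing X = ∀ {x y} → x ∈ X → y ∈ X → y ∈ N₂[ x ] → x ≡ y

  N₂⟦_⟧ : Subset n → Subset n
  N₂⟦ X ⟧ = ⋃[ x ∈ X ] N₂[ x ]

  Is2Packing⇒IsLimitedPacking : ∀ {X} → Is2Packing X → IsLimitedPacking G X
  Is2Packing⇒IsLimitedPacking {X} packing v = subsingleton⇒∣p∣≤1 (N[ v ] ∩ X) unique
    where
    unique : ∀ {x y} → x ∈ N[ v ] ∩ X → y ∈ N[ v ] ∩ X → x ≡ y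
    unique {x} {y} x∈ y∈ with x∈p∩q⁻ N[ v ] X x∈ | x∈p∩q⁻ N[ v ] X y∈
    ... | x∈N[v] , x∈X | y∈N[v] , y∈X = packing x∈X y∈X (∈⋃ᵢ⁺ (∈N[]-sym x∈N[v]) y∈N[v])

  ⁅v⁆-is2Packing : ∀ v → Is2Packing ⁅ v ⁆
  ⁅v⁆-is2Packing v x∈⁅v⁆ y∈⁅v⁆ _ = trans (x∈⁅y⁆⇒x≡y v x∈⁅v⁆) (sym (x∈⁅y⁆⇒x≡y v y∈⁅v⁆))

  insert-is2Packing : ∀ {X u} → Is2Packing X → u ∉ N₂⟦ X ⟧ → Is2Packing (⁅ u ⁆ ∪ X)
  insert-is2Packing {X} {u} packing u∉N₂⟦X⟧ {x} {y} x∈ y∈ y∈N₂[x]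
    with x∈p∪q⁻ ⁅ u ⁆ X x∈ | x∈p∪q⁻ ⁅ u ⁆ X y∈
  ... | inj₁ x∈⁅u⁆ | inj₁ y∈⁅u⁆ = ⁅v⁆-is2Packing u x∈⁅u⁆ y∈⁅u⁆ y∈N₂[x]
  ... | inj₁ x∈⁅u⁆ | inj₂ y∈X = contradiction
        (∈⋃ᵢ⁺ y∈X (∈N₂-sym (subst (λ z → y ∈ N₂[ z ]) (x∈⁅y⁆⇒x≡y u x∈⁅u⁆) y∈N₂[x]))) u∉N₂⟦X⟧
  ... | inj₂ x∈X | inj₁ y∈⁅u⁆ = contradiction
        (∈⋃ᵢ⁺ x∈X (subst (_∈ N₂[ x ]) (x∈⁅y⁆⇒x≡y u y∈⁅u⁆) y∈N₂[x])) u∉N₂⟦X⟧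
  ... | inj₂ x∈X | inj₂ y∈X = packing x∈X y∈X y∈N₂[x]

  extend-2Packing : ∀ {X} → Is2Packing X → (us : List (Fin n)) →
                    ∃ λ Y → X ⊆ Y × Is2Packing Y × All (_∈ N₂⟦ Y ⟧) us
  extend-2Packing {X} packing [] = X , (λ x∈X → x∈X) , packing , []
  extend-2Packing packing (u ∷ us) with extend-2Packing packing us
  ... | Y , X⊆Y , Y-packing , covered with u ∈? N₂⟦ Y ⟧
  ...   | yes u∈N₂⟦Y⟧ = Y , X⊆Y , Y-packing , u∈N₂⟦Y⟧ ∷ covered
  ...   | no u∉N₂⟦Y⟧ = ⁅ u ⁆ ∪ Y , q⊆p∪q ⁅ u ⁆ Y ∘ X⊆Y , insert-is2Packing Y-packing u∉N₂⟦Y⟧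
                     , ∈⋃ᵢ⁺ (x∈p∪q⁺ (inj₁ (x∈⁅x⁆ u))) (x∈N₂[x] u)
                       ∷ All.map (⋃ᵢ-mono N₂[_] (q⊆p∪q ⁅ u ⁆ Y)) covered

  maximal-2Packing : ∀ v → ∃ λ X → v ∈ X × Is2Packing X × (∀ u → u ∈ N₂⟦ X ⟧)
  maximal-2Packing v with extend-2Packing (⁅v⁆-is2Packing v) (allFin n)
  ... | X , ⁅v⁆⊆X , packing , covered =
    X , ⁅v⁆⊆X (x∈⁅x⁆ v) , packing , λ u → All.lookup covered (∈-allFin u)

  ∣X∣≤L₁ : ∀ {X} → IsLimitedPacking G X → ∣ X ∣ ℕ.≤ L₁ G
  ∣X∣≤L₁ {X} limited = ≤-foldr-⊔ (λ k → k) 0 _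
    (∈-map⁺ ∣_∣ (∈-filter⁺ (isLimitedPacking? G) (∈-allSubsets X) limited))

  covering-bound : ∀ X v → (∀ u → u ∈ N₂⟦ X ⟧) → n ℕ.≤ suc (deg v * Δ) + ∣ X - v ∣ * suc (Δ * Δ)
  covering-bound X v covered = begin
    n                                          ≡⟨ sym (∣⊤∣≡n n) ⟩
    ∣ ⊤ {n} ∣                                  ≤⟨ p⊆q⇒∣p∣≤∣q∣ {p = ⊤} (λ {u} _ → ⋃ᵢ⊆∪⋃ᵢ- X N₂[_] v (covered u)) ⟩
    ∣ N₂[ v ] ∪ N₂⟦ X - v ⟧ ∣                   ≤⟨ ∣p∪q∣≤∣p∣+∣q∣ N₂[ v ] _ ⟩
    ∣ N₂[ v ] ∣ + ∣ N₂⟦ X - v ⟧ ∣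
      ≤⟨ +-mono-≤ (∣N₂[x]∣≤1+deg*Δ v) (∣⋃ᵢ∣≤ (X - v) N₂[_] (λ {x} _ → ∣N₂[x]∣≤1+Δ² x)) ⟩
    suc (deg v * Δ) + ∣ X - v ∣ * suc (Δ * Δ)    ∎
    where
    open ≤-Reasoning
    ∣N₂[x]∣≤1+Δ² : ∀ x → ∣ N₂[ x ] ∣ ℕ.≤ suc (Δ * Δ)
    ∣N₂[x]∣≤1+Δ² x = ≤-trans (∣N₂[x]∣≤1+deg*Δ x) (s≤s (*-monoˡ-≤ Δ (deg≤Δ x)))

  nonempty⇒L₁-lower-bound : Fin n → n + Δ * (Δ ∸ δ) ℕ.≤ L₁ G * suc (Δ * Δ)
  nonempty⇒L₁-lower-bound w with minDeg-attained w
  ... | v , deg[v]≤δ with maximal-2Packing v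
  ...   | X , v∈X , packing , covered = begin
    n + Δ * (Δ ∸ δ)                                      ≤⟨ +-monoˡ-≤ _ (covering-bound X v covered) ⟩
    suc (deg v * Δ) + ∣ X - v ∣ * K + Δ * (Δ ∸ δ)         ≡⟨ xy∙z≈xz∙y (suc (deg v * Δ)) _ _ ⟩
    suc (deg v * Δ + Δ * (Δ ∸ δ)) + ∣ X - v ∣ * K         ≤⟨ +-monoˡ-≤ _ (s≤s (excess-bound Δ deg[v]≤δ (deg≤Δ v))) ⟩
    suc ∣ X - v ∣ * K                                    ≤⟨ *-monoˡ-≤ K (x∈p⇒∣p-x∣<∣p∣ v∈X) ⟩
    ∣ X ∣ * K                                            ≤⟨ *-monoˡ-≤ K (∣X∣≤L₁ (Is2Packing⇒IsLimitedPacking packing)) ⟩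
    L₁ G * K                                             ∎
    where
    open ≤-Reasoning
    K : ℕ
    K = suc (Δ * Δ)

L₁-lower-bound : ∀ n (G : Graph n) → n + Δ G * (Δ G ∸ δ G) ℕ.≤ L₁ G * suc (Δ G * Δ G)
L₁-lower-bound zero G = z≤n
L₁-lower-bound (suc n) G = nonempty⇒L₁-lower-bound G zero

-- _/_ normalises, so the comparison goes through the unnormalised rationals,
-- where ≤ is literally cross-multiplication.
/≤/⁺ : ∀ a b c d → a * suc d ℕ.≤ c * suc b → (+ a) / suc b ≤ (+ c) / suc d
/≤/⁺ a b c d ad≤cb = toℚᵘ-cancel-≤
  (ℚᵘ.≤-respˡ-≃ (ℚᵘ.≃-sym (toℚᵘ-fromℚᵘ (ℚᵘ.mkℚᵘ (+ a) b)))
  (ℚᵘ.≤-respʳ-≃ (ℚᵘ.≃-sym (toℚᵘ-fromℚᵘ (ℚᵘ.mkℚᵘ (+ c) d)))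
  (ℚᵘ.*≤* (subst₂ ℤ._≤_ (ℤ.pos-* a (suc d)) (ℤ.pos-* c (suc b)) (+≤+ ad≤cb)))))

theorem2 : (n : ℕ) (G : Graph n) →
    let Δ = maxDeg G
        δ = minDeg G
    in (ρ G ≡ L₁ G)
       × ((+ (n + Δ * (Δ ∸ δ))) / suc (Δ * Δ) ≤ (+ ρ G) / 1)
       × ((+ n) / suc (Δ * Δ) ≤ (+ (n + Δ * (Δ ∸ δ))) / suc (Δ * Δ))
theorem2 n G =
    refl
  , /≤/⁺ (n + Δ G * (Δ G ∸ δ G)) (Δ G * Δ G) (L₁ G) 0
      (≤-trans (≤-reflexive (*-identityʳ _)) (L₁-lower-bound n G))
  , /≤/⁺ n (Δ G * Δ G) (n + Δ G * (Δ G ∸ δ G)) (Δ G * Δ G)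
      (*-monoˡ-≤ (suc (Δ G * Δ G)) (m≤m+n n _))
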